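{- Let $\rho\geq\pi$ in $S_n$ (Bruhat order). For $i,j\leq n$ let $M_{[i][j]}$ denote the northwest $i\times j$ submatrix of a matrix $M$. Let $a',b'$ be such that $\mathrm{rank}\,\pi_{[a'][b']}=\mathrm{rank}\,\rho_{[a'][b']}$, and let $(a,b)$ with $a\leq a'$, $b\leq b'$ be such that the $a$-th row and $b$-th column of $\rho_{[a'][b']}$ are zero. Then the $(a,b)$ entry vanishes on every element of the tangent space $T_\rho\overline{X}_\pi$.
   Context: Permutations $\pi\in S_n$ are identified with permutation matrices having $1$'s at $(i,\pi(i))$. $\overline{X}_\pi=\overline{B_-\pi B_+}\subseteq M_n(\mathbb{C})$ is the matrix Schubert variety, with $B_-$, $B_+$ the invertible lower and upper triangular matrices acting by left and right multiplication; it is the set of matrices $M$ with $\mathrm{rank}\,M_{[i][j]}\leq\mathrm{rank}\,\pi_{[i][j]}$ for all $i,j$. The tangent space $T_\rho\overline{X}_\pi$ is the Zariski tangent space at the point $\rho\in\overline{X}_\pi$. -}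

module Defs where

open import Level using (Level; _⊔_) renaming (suc to lsuc)
open import Algebra.Bundles using (CommutativeRing)
open import Data.Nat using (ℕ; zero; suc; _≤_; _<_)
open import Data.Fin using (Fin; zero; suc; toℕ; punchIn)
open import Data.Fin.Permutation using (Permutation′; _⟨$⟩ʳ_)
open import Data.Fin.Properties using () renaming (_≟_ to _≟F_)
open import Data.List using (List; []; _∷_)
open import Data.Product using (∃)
open import Relation.Nullary using (¬_; yes; no)

record Field (c ℓ : Level) : Set (lsuc (c ⊔ ℓ)) where
  field
    commutativeRing : CommutativeRing c ℓ
  open CommutativeRing commutativeRing public
    using (Carrier; _≈_; _+_; _*_; -_; 0#; 1#)
  field
    1≉0     : ¬ (1# ≈ 0#)
    inverse : ∀ x → ¬ (x ≈ 0#) → ∃ λ y → (x * y) ≈ 1#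

module _ {c ℓ : Level} (F : Field c ℓ) where
  open Field F

  -- Horner evaluation of the monic polynomial
  --   c₀ + c₁ x + … + c_{m-1} x^{m-1} + x^m   (cs = c₀ ∷ … ∷ c_{m-1})
  monicEval : List Carrier → Carrier → Carrier
  monicEval []       x = 1#
  monicEval (c ∷ cs) x = c + x * monicEval cs x

  AlgClosed : Set (c ⊔ ℓ)
  AlgClosed = ∀ c₀ cs → ∃ λ x → monicEval (c₀ ∷ cs) x ≈ 0#

  fromℕ : ℕ → Carrier
  fromℕ zero    = 0#
  fromℕ (suc m) = 1# + fromℕ m

  CharZero : Set ℓ
  CharZero = ∀ m → ¬ (fromℕ (suc m) ≈ 0#)

  Mat : ℕ → ℕ → Set c
  Mat m k = Fin m → Fin k → Carrier

  sumF : ∀ {k} → (Fin k → Carrier) → Carrier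
  sumF {zero}  f = 0#
  sumF {suc k} f = f zero + sumF (λ j → f (suc j))

  signed : ∀ {k} → Fin k → Carrier → Carrier
  signed zero    x = x
  signed (suc j) x = - signed j x

  det : ∀ {k} → Mat k k → Carrier
  det {zero}  M = 1#
  det {suc k} M = sumF λ j → signed j (M zero j * det (λ s t → M (suc s) (punchIn j t)))

  -- Minors are given by arbitrary choices of r+1 rows
  -- (among the first i) and r+1 columns (among the first j); choices with
  -- repetitions or in non-increasing order only add zero / sign-changed minors.
  NWRankLE : ∀ {n} → Mat n n → ℕ → ℕ → ℕ → Set ℓ
  NWRankLE {n} M i j r =
    (f g : Fin (suc r) → Fin n) → (∀ s → toℕ (f s) < i) → (∀ t → toℕ (g t) < j) →
    det (λ s t → M (f s) (g t)) ≈ 0#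

pmN : ∀ {n} → Permutation′ n → Fin n → Fin n → ℕ
pmN π i j with (π ⟨$⟩ʳ i) ≟F j
... | yes _ = 1
... | no  _ = 0

sumℕ : ∀ {k} → (Fin k → ℕ) → ℕ
sumℕ {zero}  f = 0
sumℕ {suc k} f = f zero Data.Nat.+ sumℕ (λ j → f (suc j))

below : ∀ {n} → Fin n → ℕ → ℕ
below k a with suc (toℕ k) Data.Nat.≤? a
... | yes _ = 1
... | no  _ = 0

-- rank π_{[a][b]} = #{ k < a : π(k) < b }  (0-indexed rows/columns)
rankPerm : ∀ {n} → Permutation′ n → ℕ → ℕ → ℕ
rankPerm {n} π a b = sumℕ λ k → below k a Data.Nat.* below (π ⟨$⟩ʳ k) b

-- Bruhat order π ≤ ρ, via the rank (tableau) criterion: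
-- rank ρ_{[i][j]} ≤ rank π_{[i][j]} for all i, j
_≤B_ : ∀ {n} → Permutation′ n → Permutation′ n → Set
_≤B_ {n} π ρ = ∀ i j → i ≤ n → j ≤ n → rankPerm ρ i j ≤ rankPerm π i j

module _ {c ℓ : Level} (F : Field c ℓ) where
  open Field F

  permMat : ∀ {n} → Permutation′ n → Mat F n n
  permMat π i j with (π ⟨$⟩ʳ i) ≟F j
  ... | yes _ = 1#
  ... | no  _ = 0#

  InSchubert : ∀ {n} → Permutation′ n → Mat F n n → Set ℓ
  InSchubert {n} π M = ∀ i j → i ≤ n → j ≤ n → NWRankLE F M i j (rankPerm π i j)

  data Poly (n : ℕ) : Set c where
    var : Fin n → Fin n → Poly n
    con : Carrier → Poly n
    _⊕_ : Poly n → Poly n → Poly n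
    _⊗_ : Poly n → Poly n → Poly n
    neg : Poly n → Poly n

  eval : ∀ {n} → Poly n → Mat F n n → Carrier
  eval (var i j) M = M i j
  eval (con x)   M = x
  eval (p ⊕ q)   M = eval p M + eval q M
  eval (p ⊗ q)   M = eval p M * eval q M
  eval (neg p)   M = - eval p M

  deriv : ∀ {n} → Poly n → Mat F n n → Mat F n n → Carrier
  deriv (var i j) M V = V i j
  deriv (con x)   M V = 0#
  deriv (p ⊕ q)   M V = deriv p M V + deriv q M V
  deriv (p ⊗ q)   M V = eval p M * deriv q M V + deriv p M V * eval q M
  deriv (neg p)   M V = - deriv p M V

  VanishesOn : ∀ {n} → Permutation′ n → Poly n → Set (c ⊔ ℓ)
  VanishesOn π p = ∀ M → InSchubert π M → eval p M ≈ 0#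

  Tangent : ∀ {n} → Permutation′ n → Permutation′ n → Mat F n n → Set (c ⊔ ℓ)
  Tangent π ρ V = ∀ p → VanishesOn π p → deriv p (permMat ρ) V ≈ 0#

{-# OPTIONS --safe #-}
-- Let r = rank π_{[a′][b′]} = rank ρ_{[a′][b′]} and let e₁,…,e_r be the rows k < a′ with ρ(k) < b′.
-- The (r+1)-minor Δ of x on rows a,e₁,…,e_r and columns b,ρ(e₁),…,ρ(e_r) lies in the northwest
-- a′×b′ corner, so Δ ∈ I(X̄_π) and (dΔ)_ρ(V) = 0.  Expanding Δ along row a, which vanishes at ρ,
-- (dΔ)_ρ(V) is the signed sum over the columns c of Δ of V(a,c) times the minor of ρ complementary
-- to (a,c).  For c = b that minor is an identity matrix; for every other c it contains column b of ρ,
-- which is zero on the rows e₁,…,e_r.  Hence (dΔ)_ρ(V) = V(a,b).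
module Submission where

open import Defs
open import Algebra.Bundles using (CommutativeRing)
import Algebra.Properties.Ring as RingProperties
open import Data.Fin using (Fin; toℕ; zero; suc; punchIn)
open import Data.Fin.Permutation using (Permutation′; _⟨$⟩ʳ_)
open import Data.Fin.Properties using (suc-injective) renaming (_≟_ to _≟F_)
open import Data.Nat as ℕ using (ℕ; _≤_; _<_; s≤s; z≤n; _≤?_)
open import Data.Nat.Properties using (*-mono-≤; m*n≡1⇒m≡1; m*n≡1⇒n≡1)
open import Data.Product using (Σ-syntax; _×_; _,_; proj₁; proj₂)
open import Data.Vec.Functional using (_∷_)
open import Function using (_∘_)
open import Function.Bundles using (Injection)
open import Function.Definitions using (Injective)
open import Function.Properties.Inverse using (↔⇒↣)
open import Relation.Binary.PropositionalEquality as ≡ using (_≡_; _≢_)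
open import Relation.Nullary using (yes; no; contradiction)

enumerate : ∀ {n} (h : Fin n → ℕ) → (∀ k → h k ≤ 1) →
  Σ[ e ∈ (Fin (sumℕ h) → Fin n) ] Injective _≡_ _≡_ e × (∀ s → h (e s) ≡ 1)
enumerate {ℕ.zero} h h≤1 = (λ ()) , (λ { {()} }) , (λ ())
enumerate {ℕ.suc n} h h≤1 with enumerate (h ∘ suc) (h≤1 ∘ suc) | h zero in h₀ | h≤1 zero
... | e , e-inj , hits | 0 | _ = suc ∘ e , e-inj ∘ suc-injective , hits
... | e , e-inj , hits | 1 | _ = zero ∷ suc ∘ e , inj , hits′
  where
  inj : Injective _≡_ _≡_ (zero ∷ suc ∘ e)
  inj {zero}  {zero}  _  = ≡.refl
  inj {suc s} {suc t} eq = ≡.cong suc (e-inj (suc-injective eq))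
  inj {zero}  {suc _} ()
  inj {suc _} {zero}  ()
  hits′ : ∀ s → h ((zero ∷ suc ∘ e) s) ≡ 1
  hits′ zero    = h₀
  hits′ (suc s) = hits s
... | _ | ℕ.suc (ℕ.suc _) | s≤s ()

below≤1 : ∀ {n} (k : Fin n) a → below k a ≤ 1
below≤1 k a with ℕ.suc (toℕ k) ≤? a
... | yes _ = s≤s z≤n
... | no  _ = z≤n

below≡1⇒< : ∀ {n} (k : Fin n) a → below k a ≡ 1 → toℕ k < a
below≡1⇒< k a eq with ℕ.suc (toℕ k) ≤? a
below≡1⇒< k a ()  | no  _
below≡1⇒< k a eq  | yes k<a = k<a

cornerRows : ∀ {n} (ρ : Permutation′ n) a′ b′ →
  Σ[ e ∈ (Fin (rankPerm ρ a′ b′) → Fin n) ]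
    Injective _≡_ _≡_ e × (∀ s → toℕ (e s) < a′ × toℕ (ρ ⟨$⟩ʳ e s) < b′)
cornerRows ρ a′ b′ with enumerate (λ k → below k a′ ℕ.* below (ρ ⟨$⟩ʳ k) b′)
                                  (λ k → *-mono-≤ (below≤1 k a′) (below≤1 (ρ ⟨$⟩ʳ k) b′))
... | e , e-inj , hits = e , e-inj , corner
  where
  corner : ∀ s → toℕ (e s) < a′ × toℕ (ρ ⟨$⟩ʳ e s) < b′
  corner s = below≡1⇒< (e s) a′ (m*n≡1⇒m≡1 _ (below (ρ ⟨$⟩ʳ e s) b′) (hits s))
           , below≡1⇒< (ρ ⟨$⟩ʳ e s) b′ (m*n≡1⇒n≡1 (below (e s) a′) _ (hits s))

pmN≡0⇒≢ : ∀ {n} (ρ : Permutation′ n) i j → pmN ρ i j ≡ 0 → ρ ⟨$⟩ʳ i ≢ j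
pmN≡0⇒≢ ρ i j pmN≡0 with (ρ ⟨$⟩ʳ i) ≟F j
pmN≡0⇒≢ ρ i j ()    | yes _
pmN≡0⇒≢ ρ i j _     | no ρi≢j = ρi≢j

⟨$⟩ʳ-injective : ∀ {n} (ρ : Permutation′ n) → Injective _≡_ _≡_ (ρ ⟨$⟩ʳ_)
⟨$⟩ʳ-injective ρ = Injection.injective (↔⇒↣ ρ)

minor : ∀ {a} {A : Set a} {k} → (Fin (ℕ.suc k) → Fin (ℕ.suc k) → A) → Fin (ℕ.suc k) → Fin k → Fin k → A
minor M j s t = M (suc s) (punchIn j t)

module _ {c ℓ} (F : Field c ℓ) where
  open Field F using (commutativeRing)
  open CommutativeRing commutativeRing hiding (zero)
  open RingProperties ring using (-0#≈0#)
  open import Relation.Binary.Reasoning.Setoid setoid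

  sumF-cong : ∀ {k} {f g : Fin k → Carrier} → (∀ j → f j ≈ g j) → sumF F f ≈ sumF F g
  sumF-cong {ℕ.zero}  f≈g = refl
  sumF-cong {ℕ.suc k} f≈g = +-cong (f≈g zero) (sumF-cong (f≈g ∘ suc))

  sumF-zero : ∀ {k} {f : Fin k → Carrier} → (∀ j → f j ≈ 0#) → sumF F f ≈ 0#
  sumF-zero {ℕ.zero}  f≈0 = refl
  sumF-zero {ℕ.suc k} f≈0 = trans (+-cong (f≈0 zero) (sumF-zero (f≈0 ∘ suc))) (+-identityʳ 0#)

  sumF-head : ∀ {k} {f : Fin (ℕ.suc k) → Carrier} → (∀ j → f (suc j) ≈ 0#) → sumF F f ≈ f zero
  sumF-head tail≈0 = trans (+-cong refl (sumF-zero tail≈0)) (+-identityʳ _)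

  signed-cong : ∀ {k} (j : Fin k) {x y} → x ≈ y → signed F j x ≈ signed F j y
  signed-cong zero    x≈y = x≈y
  signed-cong (suc j) x≈y = -‿cong (signed-cong j x≈y)

  signed-zero : ∀ {k} (j : Fin k) {x} → x ≈ 0# → signed F j x ≈ 0#
  signed-zero zero    x≈0 = x≈0
  signed-zero (suc j) x≈0 = trans (-‿cong (signed-zero j x≈0)) -0#≈0#

  x≈0⇒x*y≈0 : ∀ {x y} → x ≈ 0# → x * y ≈ 0#
  x≈0⇒x*y≈0 x≈0 = trans (*-cong x≈0 refl) (zeroˡ _)

  y≈0⇒x*y≈0 : ∀ {x y} → y ≈ 0# → x * y ≈ 0#
  y≈0⇒x*y≈0 y≈0 = trans (*-cong refl y≈0) (zeroʳ _)

  laplaceTerm : ∀ {k} → Mat F (ℕ.suc k) (ℕ.suc k) → Fin (ℕ.suc k) → Carrier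
  laplaceTerm M j = signed F j (M zero j * det F (minor M j))

  mutual
    det-firstColumn-zero : ∀ {k} (M : Mat F (ℕ.suc k) (ℕ.suc k)) → (∀ s → M s zero ≈ 0#) → det F M ≈ 0#
    det-firstColumn-zero M col≈0 = sumF-zero {f = laplaceTerm M} λ
      { zero    → x≈0⇒x*y≈0 (col≈0 zero)
      ; (suc j) → signed-zero (suc j) (y≈0⇒x*y≈0 (det-minor-suc-zero M j (col≈0 ∘ suc)))
      }

    -- for j ≠ 0 the minor keeps column 0 of M
    det-minor-suc-zero : ∀ {k} (M : Mat F (ℕ.suc k) (ℕ.suc k)) (j : Fin k) →
      (∀ s → M (suc s) zero ≈ 0#) → det F (minor M (suc j)) ≈ 0#
    det-minor-suc-zero {ℕ.suc k} M j col≈0 = det-firstColumn-zero (minor M (suc j)) col≈0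

  det-identity : ∀ {k} (M : Mat F k k) → (∀ s → M s s ≈ 1#) → (∀ s t → s ≢ t → M s t ≈ 0#) → det F M ≈ 1#
  det-identity {ℕ.zero}  M diag off = refl
  det-identity {ℕ.suc k} M diag off = begin
    det F M                            ≈⟨ sumF-head {f = laplaceTerm M} offTerm≈0 ⟩
    M zero zero * det F (minor M zero) ≈⟨ *-cong (diag zero) (det-identity (minor M zero) (diag ∘ suc) off′) ⟩
    1# * 1#                            ≈⟨ *-identityʳ 1# ⟩
    1#                                 ∎
    where
    off′ : ∀ s t → s ≢ t → minor M zero s t ≈ 0#
    off′ s t s≢t = off (suc s) (suc t) (s≢t ∘ suc-injective)
    offTerm≈0 : ∀ j → laplaceTerm M (suc j) ≈ 0#
    offTerm≈0 j = signed-zero (suc j) (x≈0⇒x*y≈0 (off zero (suc j) λ ()))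

  sumPoly : ∀ {n k} → (Fin k → Poly F n) → Poly F n
  sumPoly {k = ℕ.zero}  f = con 0#
  sumPoly {k = ℕ.suc k} f = f zero ⊕ sumPoly (f ∘ suc)

  signedPoly : ∀ {n k} → Fin k → Poly F n → Poly F n
  signedPoly zero    p = p
  signedPoly (suc j) p = neg (signedPoly j p)

  mutual
    detPoly : ∀ {n k} → (Fin k → Fin k → Poly F n) → Poly F n
    detPoly {k = ℕ.zero}  Q = con 1#
    detPoly {k = ℕ.suc k} Q = sumPoly (laplaceTermPoly Q)

    laplaceTermPoly : ∀ {n k} → (Fin (ℕ.suc k) → Fin (ℕ.suc k) → Poly F n) → Fin (ℕ.suc k) → Poly F n
    laplaceTermPoly Q j = signedPoly j (Q zero j ⊗ detPoly (minor Q j))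

  evalMat : ∀ {n k} → (Fin k → Fin k → Poly F n) → Mat F n n → Mat F k k
  evalMat Q M s t = eval F (Q s t) M

  eval-sumPoly : ∀ {n k} (f : Fin k → Poly F n) M → eval F (sumPoly f) M ≈ sumF F (λ j → eval F (f j) M)
  eval-sumPoly {k = ℕ.zero}  f M = refl
  eval-sumPoly {k = ℕ.suc k} f M = +-cong refl (eval-sumPoly (f ∘ suc) M)

  eval-signedPoly : ∀ {n k} (j : Fin k) (p : Poly F n) M →
    eval F (signedPoly j p) M ≈ signed F j (eval F p M)
  eval-signedPoly zero    p M = refl
  eval-signedPoly (suc j) p M = -‿cong (eval-signedPoly j p M)

  deriv-sumPoly : ∀ {n k} (f : Fin k → Poly F n) M V →
    deriv F (sumPoly f) M V ≈ sumF F (λ j → deriv F (f j) M V)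
  deriv-sumPoly {k = ℕ.zero}  f M V = refl
  deriv-sumPoly {k = ℕ.suc k} f M V = +-cong refl (deriv-sumPoly (f ∘ suc) M V)

  deriv-signedPoly : ∀ {n k} (j : Fin k) (p : Poly F n) M V →
    deriv F (signedPoly j p) M V ≈ signed F j (deriv F p M V)
  deriv-signedPoly zero    p M V = refl
  deriv-signedPoly (suc j) p M V = -‿cong (deriv-signedPoly j p M V)

  eval-detPoly : ∀ {n k} (Q : Fin k → Fin k → Poly F n) M → eval F (detPoly Q) M ≈ det F (evalMat Q M)
  eval-detPoly {k = ℕ.zero}  Q M = refl
  eval-detPoly {k = ℕ.suc k} Q M = trans (eval-sumPoly (laplaceTermPoly Q) M) (sumF-cong λ j →
    trans (eval-signedPoly j (Q zero j ⊗ detPoly (minor Q j)) M)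
          (signed-cong j (*-cong refl (eval-detPoly (minor Q j) M))))

  deriv-detPoly-firstRow-zero : ∀ {n k} (Q : Fin (ℕ.suc k) → Fin (ℕ.suc k) → Poly F n) M V →
    (∀ j → eval F (Q zero j) M ≈ 0#) →
    deriv F (detPoly Q) M V ≈ sumF F (λ j → signed F j (deriv F (Q zero j) M V * det F (minor (evalMat Q M) j)))
  deriv-detPoly-firstRow-zero Q M V row≈0 = trans (deriv-sumPoly (laplaceTermPoly Q) M V) (sumF-cong λ j →
    trans (deriv-signedPoly j (Q zero j ⊗ detPoly (minor Q j)) M V) (signed-cong j (begin
      eval F (Q zero j) M * deriv F (detPoly (minor Q j)) M V + deriv F (Q zero j) M V * eval F (detPoly (minor Q j)) M
        ≈⟨ +-cong (x≈0⇒x*y≈0 (row≈0 j)) (*-cong refl (eval-detPoly (minor Q j) M)) ⟩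
      0# + deriv F (Q zero j) M V * det F (minor (evalMat Q M) j)
        ≈⟨ +-identityˡ _ ⟩
      deriv F (Q zero j) M V * det F (minor (evalMat Q M) j) ∎)))

  permMat-≡ : ∀ {n} (ρ : Permutation′ n) i → permMat F ρ i (ρ ⟨$⟩ʳ i) ≈ 1#
  permMat-≡ ρ i with (ρ ⟨$⟩ʳ i) ≟F (ρ ⟨$⟩ʳ i)
  ... | yes _     = refl
  ... | no ρi≢ρi = contradiction ≡.refl ρi≢ρi

  permMat-≢ : ∀ {n} (ρ : Permutation′ n) i j → ρ ⟨$⟩ʳ i ≢ j → permMat F ρ i j ≈ 0#
  permMat-≢ ρ i j ρi≢j with (ρ ⟨$⟩ʳ i) ≟F j
  ... | yes ρi≡j = contradiction ρi≡j ρi≢j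
  ... | no _     = refl

  det-permMat-graph : ∀ {n r} (ρ : Permutation′ n) (e : Fin r → Fin n) → Injective _≡_ _≡_ e →
    det F (λ s t → permMat F ρ (e s) (ρ ⟨$⟩ʳ e t)) ≈ 1#
  det-permMat-graph ρ e e-inj = det-identity _ (λ s → permMat-≡ ρ (e s))
    (λ s t s≢t → permMat-≢ ρ (e s) (ρ ⟨$⟩ʳ e t) (s≢t ∘ e-inj ∘ ⟨$⟩ʳ-injective ρ))

  minorPoly : ∀ {n k} → (Fin k → Fin n) → (Fin k → Fin n) → Poly F n
  minorPoly f g = detPoly λ s t → var (f s) (g t)

  minorPoly-vanishes : ∀ {n r} (π : Permutation′ n) {i j} → i ≤ n → j ≤ n → rankPerm π i j ≡ r →
    (f g : Fin (ℕ.suc r) → Fin n) → (∀ s → toℕ (f s) < i) → (∀ t → toℕ (g t) < j) →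
    VanishesOn F π (minorPoly f g)
  minorPoly-vanishes π {i} {j} i≤n j≤n ≡.refl f g f<i g<j M M∈X̄π =
    trans (eval-detPoly (λ s t → var (f s) (g t)) M) (M∈X̄π i j i≤n j≤n f g f<i g<j)

  deriv-minorPoly-permMat : ∀ {n r} (ρ : Permutation′ n) (V : Mat F n n) (a b : Fin n) (e : Fin r → Fin n) →
    Injective _≡_ _≡_ e → (∀ t → ρ ⟨$⟩ʳ a ≢ (b ∷ (ρ ⟨$⟩ʳ_) ∘ e) t) → (∀ s → ρ ⟨$⟩ʳ e s ≢ b) →
    deriv F (minorPoly (a ∷ e) (b ∷ (ρ ⟨$⟩ʳ_) ∘ e)) (permMat F ρ) V ≈ V a b
  deriv-minorPoly-permMat {r = r} ρ V a b e e-inj row-a col-b = begin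
    deriv F (detPoly Q) R V                      ≈⟨ deriv-detPoly-firstRow-zero Q R V row-a≈0 ⟩
    sumF F term                                  ≈⟨ sumF-head {f = term} term-suc≈0 ⟩
    V a b * det F (λ s t → R (e s) (ρ ⟨$⟩ʳ e t)) ≈⟨ *-cong refl (det-permMat-graph ρ e e-inj) ⟩
    V a b * 1#                                   ≈⟨ *-identityʳ _ ⟩
    V a b                                        ∎
    where
    R = permMat F ρ
    cols = b ∷ (ρ ⟨$⟩ʳ_) ∘ e
    Q : Fin (ℕ.suc r) → Fin (ℕ.suc r) → Poly F _
    Q s t = var ((a ∷ e) s) (cols t)
    row-a≈0 : ∀ t → R a (cols t) ≈ 0#
    row-a≈0 t = permMat-≢ ρ a (cols t) (row-a t)
    term : Fin (ℕ.suc r) → Carrier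
    term j = signed F j (V a (cols j) * det F (minor (evalMat Q R) j))
    term-suc≈0 : ∀ j → term (suc j) ≈ 0#
    term-suc≈0 j = signed-zero (suc j)
      (y≈0⇒x*y≈0 (det-minor-suc-zero (evalMat Q R) j λ s → permMat-≢ ρ (e s) b (col-b s)))

lemma4p3 : ∀ {c ℓ} (F : Field c ℓ) → AlgClosed F → CharZero F →
    ∀ n (π ρ : Permutation′ n) → π ≤B ρ →
    ∀ (a′ b′ : ℕ) → a′ ≤ n → b′ ≤ n → rankPerm π a′ b′ ≡ rankPerm ρ a′ b′ →
    ∀ (a b : Fin n) → toℕ a < a′ → toℕ b < b′ →
    (∀ l → toℕ l < b′ → pmN ρ a l ≡ 0) →
    (∀ k → toℕ k < a′ → pmN ρ k b ≡ 0) →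
    ∀ (V : Fin n → Fin n → Field.Carrier F) → Tangent F π ρ V →
    Field._≈_ F (V a b) (Field.0# F)
lemma4p3 F _ _ n π ρ _ a′ b′ a′≤n b′≤n rank≡ a b a<a′ b<b′ row-a col-b V tangent
  with cornerRows ρ a′ b′
... | e , e-inj , e-corner =
  trans (sym (deriv-minorPoly-permMat F ρ V a b e e-inj (λ t → ρa≢ (cols<b′ t)) ρe≢b))
        (tangent (minorPoly F rows cols)
                 (minorPoly-vanishes F π a′≤n b′≤n rank≡ rows cols rows<a′ cols<b′))
  where
  open CommutativeRing (Field.commutativeRing F) using (sym; trans)
  rows = a ∷ e
  cols = b ∷ (ρ ⟨$⟩ʳ_) ∘ e
  rows<a′ : ∀ s → toℕ (rows s) < a′
  rows<a′ zero    = a<a′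
  rows<a′ (suc s) = proj₁ (e-corner s)
  cols<b′ : ∀ t → toℕ (cols t) < b′
  cols<b′ zero    = b<b′
  cols<b′ (suc t) = proj₂ (e-corner t)
  ρa≢ : ∀ {l} → toℕ l < b′ → ρ ⟨$⟩ʳ a ≢ l
  ρa≢ l<b′ = pmN≡0⇒≢ ρ a _ (row-a _ l<b′)
  ρe≢b : ∀ s → ρ ⟨$⟩ʳ e s ≢ b
  ρe≢b s = pmN≡0⇒≢ ρ (e s) b (col-b (e s) (proj₁ (e-corner s)))
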